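{- Let $w\in S_\infty$, $n\ge1$, $\varphi$ a flag and $1\le i<n$. If $r^{(\bullet)}\in\mathrm{RF}_n(w)$ is $\varphi$-flagged, then $e_i(r^{(\bullet)})$ is either $0$ or $\varphi$-flagged.
   Context: $s_i\in S_\infty$ swaps $i,i+1$; $i_1\cdots i_m$ is reduced for $w$ if $w=s_{i_1}\cdots s_{i_m}$ with $m$ minimal. $\mathrm{RF}_n(w)$ is the set of increasing factorizations $r^{(\bullet)}=(r^{(n)}|\cdots|r^{(1)})$ of reduced words for $w$ into exactly $n$ consecutive, possibly empty, strictly increasing subwords ($r=r^{(n)}\cdots r^{(1)}$). A flag is a weakly increasing $\varphi:\mathbb{Z}_{>0}\to\mathbb{Z}_{>0}$ with $\varphi(m)\ge m$; $r^{(\bullet)}$ is $\varphi$-flagged if $\varphi(r^{(j)}_1)\ge j$ for each nonempty $r^{(j)}$ (first letter $r^{(j)}_1$). Raising operator (Morse–Schilling): take the elements $b$ of $r^{(i)}$ in decreasing order, pairing each with the smallest not-yet-paired $a\in r^{(i+1)}$ with $a>b$ (if none, $b$ is unpaired). Let $L_i$ be the set of unpaired letters of $r^{(i+1)}$. If $L_i=\varnothing$ then $e_i(r^{(\bullet)})=0$; otherwise with $a=\max L_i$ and $s=\min\{j\ge0:a+j+1\notin r^{(i+1)}\}$, $e_i(r^{(\bullet)})$ is obtained by removing $a$ from $r^{(i+1)}$ and adding $a+s$ to $r^{(i)}$. -}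

module Defs where

open import Data.Nat using (ℕ; zero; suc; _+_; _≤_; _<_; _<ᵇ_; _≡ᵇ_)
open import Data.Bool using (Bool; true; false; if_then_else_)
open import Data.List using (List; []; _∷_; length; reverse; concat)
open import Data.List.Relation.Unary.All using (All)
open import Data.List.Relation.Unary.Linked using (Linked)
open import Data.Maybe using (Maybe; just; nothing)
open import Data.Vec using (Vec; toList)
open import Data.Product using (_×_)
open import Relation.Binary.PropositionalEquality using (_≡_)

swap : ℕ → ℕ → ℕ
swap i k = if k ≡ᵇ i then suc i else (if k ≡ᵇ suc i then i else k)

act : List ℕ → ℕ → ℕ
act []      k = k
act (i ∷ r) k = swap i (act r k)

PosWord : List ℕ → Set
PosWord r = All (λ i → 1 ≤ i) r

-- An element of S_∞ is given by any word in the generators s_i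
-- (every element of S_∞ is such a product); two words denote the
-- same element iff they act identically on ℤ_{>0}.
SInf : Set
SInf = List ℕ

Denotes : List ℕ → SInf → Set
Denotes r w = ∀ k → 1 ≤ k → act r k ≡ act w k

Reduced : List ℕ → SInf → Set
Reduced r w = PosWord r × Denotes r w ×
              (∀ u → PosWord u → Denotes u w → length r ≤ length u)

-- A factorization into n pieces; component at Vec-position k (0-based)
-- is r^(k+1).  So the word is r = r^(n) ⋯ r^(1).
Fact : ℕ → Set
Fact n = Vec (List ℕ) n

word : ∀ {n} → Fact n → List ℕ
word v = concat (reverse (toList v))

Increasing : List ℕ → Set
Increasing = Linked _<_

RF : (n : ℕ) → SInf → Fact n → Set
RF n w v = All Increasing (toList v) × Reduced (word v) w

-- component r^(j) (1-based, j ≥ 1); [] outside 1..n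
comp : ∀ {n} → Fact n → ℕ → List ℕ
comp v j = go (toList v) j
  where
  go : List (List ℕ) → ℕ → List ℕ
  go []       _             = []
  go (x ∷ xs) zero          = []
  go (x ∷ xs) (suc zero)    = x
  go (x ∷ xs) (suc (suc j)) = go xs (suc j)

-- replace r^(j) (1-based)
setComp : ∀ {n} → ℕ → List ℕ → Fact n → Fact n
setComp j x Vec.[] = Vec.[]
setComp zero x (y Vec.∷ ys) = y Vec.∷ ys
setComp (suc zero) x (y Vec.∷ ys) = x Vec.∷ ys
setComp (suc (suc j)) x (y Vec.∷ ys) = y Vec.∷ setComp (suc j) x ys

-- φ : ℤ_{>0} → ℤ_{>0} weakly increasing with φ(m) ≥ m (value at 0 irrelevant).
IsFlag : (ℕ → ℕ) → Set
IsFlag φ = (∀ m m' → 1 ≤ m → m ≤ m' → φ m ≤ φ m') × (∀ m → 1 ≤ m → m ≤ φ m)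

Flagged : ∀ {n} → (ℕ → ℕ) → Fact n → Set
Flagged {n} φ v = ∀ j a rest → 1 ≤ j → j ≤ n → comp v j ≡ a ∷ rest → j ≤ φ a

removeFirstAbove : ℕ → List ℕ → List ℕ
removeFirstAbove b []       = []
removeFirstAbove b (a ∷ as) = if b <ᵇ a then as else a ∷ removeFirstAbove b as

-- unpaired letters of `upper` (= r^(i+1)) after pairing with `lower` (= r^(i)),
-- the letters of `lower` processed in decreasing order.
unpaired : (lower upper : List ℕ) → List ℕ
unpaired lower upper = go (reverse lower) upper
  where
  go : List ℕ → List ℕ → List ℕ
  go []       rem = rem
  go (b ∷ bs) rem = go bs (removeFirstAbove b rem)

lastM : List ℕ → Maybe ℕ
lastM []           = nothing
lastM (x ∷ [])     = just x
lastM (x ∷ y ∷ xs) = lastM (y ∷ xs)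

member : ℕ → List ℕ → Bool
member x []       = false
member x (y ∷ ys) = if x ≡ᵇ y then true else member x ys

-- s = min { j ≥ 0 : a + j + 1 ∉ r }, searched with fuel (fuel = |r| + 1 suffices)
findS : ℕ → List ℕ → ℕ → ℕ → ℕ
findS a r zero       j = j
findS a r (suc fuel) j = if member (a + j + 1) r then findS a r fuel (suc j) else j

remove : ℕ → List ℕ → List ℕ
remove x []       = []
remove x (y ∷ ys) = if x ≡ᵇ y then ys else y ∷ remove x ys

insert : ℕ → List ℕ → List ℕ
insert x []       = x ∷ []
insert x (y ∷ ys) = if x <ᵇ y then x ∷ y ∷ ys else y ∷ insert x ys

-- e_i ; nothing represents 0
raise : ∀ {n} → ℕ → Fact n → Maybe (Fact n)
raise i v with lastM (unpaired (comp v i) (comp v (suc i)))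
... | nothing = nothing
... | just a  =
  let up  = comp v (suc i)
      s   = findS a up (suc (length up)) 0
  in just (setComp i (insert (a + s) (comp v i))
            (setComp (suc i) (remove a up) v))

-- The letter a moved by e_i is an unpaired letter of r^(i+1), and it reaches r^(i) as a + s ≥ a.
-- Since r^(i+1) is increasing and φ is weakly increasing, every letter x of r^(i+1) satisfies
-- φ(x) ≥ φ(r^(i+1)_1) ≥ i + 1.  Hence the new first letter of r^(i) is either the old one or
-- a + s with φ(a + s) ≥ φ(a) ≥ i + 1, and the new first letter of r^(i+1) is still a letter of
-- the old r^(i+1); all other factors are unchanged.
module Submission where

open import Defs
open import Data.Nat using (ℕ; zero; suc; _+_; _≤_; _<_; _<ᵇ_; _≡ᵇ_; _≟_; s≤s; z≤n)
open import Data.Nat.Properties using (≤-refl; ≤-trans; <⇒≤; m≤m+n; n≤1+n)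
open import Data.Bool using (true; false)
open import Data.List using (List; []; _∷_; length; reverse)
open import Data.List.Relation.Unary.All as All using (All; []; _∷_)
open import Data.List.Relation.Unary.All.Properties using (concat⁻)
open import Data.List.Relation.Unary.Linked as Linked using ([])
open import Data.List.Relation.Unary.Linked.Properties using (Linked⇒All)
open import Data.List.Relation.Binary.Permutation.Propositional.Properties
  using (All-resp-↭; ↭-reverse)
open import Data.Maybe using (just; nothing)
open import Data.Vec using (Vec; toList)
open import Data.Product using (Σ; _×_; _,_; proj₂)
open import Data.Sum using (_⊎_; inj₁; inj₂)
open import Relation.Nullary using (yes; no; ¬_)
open import Relation.Binary.PropositionalEquality using (_≡_; refl; sym; trans; cong; subst)

componentAt : List (List ℕ) → ℕ → List ℕ
componentAt []       _             = []
componentAt (x ∷ xs) zero          = []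
componentAt (x ∷ xs) (suc zero)    = x
componentAt (x ∷ xs) (suc (suc j)) = componentAt xs (suc j)

-- `comp` and `unpaired` are defined through local helpers that cannot be named from outside
-- Defs.  The metavariables `compLoop` and `pairingLoop` are solved, by unification with the
-- goals produced by the `with`-abstractions below, to exactly those helpers.
mutual
  compLoop : ∀ {n} → Fact n → ℕ → List (List ℕ) → ℕ → List ℕ
  compLoop = _

  comp-suc-suc-componentAt : ∀ {n} x (xs : Fact n) j →
                             comp (x Vec.∷ xs) (suc (suc j)) ≡ componentAt (toList xs) (suc j)
  comp-suc-suc-componentAt {n} x xs j with toList xs
  ... | ys with suc (suc j)
  ... | m with suc j
  ... | k with suc n | x Vec.∷ xs
  ... | N | v = compLoop≡componentAt v m ys k

  compLoop≡componentAt : ∀ {n} (v : Fact n) m xs k → compLoop v m xs k ≡ componentAt xs k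
  compLoop≡componentAt v m []       k             = refl
  compLoop≡componentAt v m (y ∷ ys) zero          = refl
  compLoop≡componentAt v m (y ∷ ys) (suc zero)    = refl
  compLoop≡componentAt v m (y ∷ ys) (suc (suc k)) = compLoop≡componentAt v m ys (suc k)

comp≡componentAt : ∀ {n} (v : Fact n) j → comp v j ≡ componentAt (toList v) j
comp≡componentAt Vec.[]       j             = refl
comp≡componentAt (x Vec.∷ xs) zero          = refl
comp≡componentAt (x Vec.∷ xs) (suc zero)    = refl
comp≡componentAt (x Vec.∷ xs) (suc (suc j)) = comp-suc-suc-componentAt x xs j

comp-suc-suc : ∀ {n} x (xs : Fact n) j → comp (x Vec.∷ xs) (suc (suc j)) ≡ comp xs (suc j)
comp-suc-suc x xs j = trans (comp-suc-suc-componentAt x xs j) (sym (comp≡componentAt xs (suc j)))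

comp-All : ∀ {n} {Q : List ℕ → Set} (v : Fact n) → Q [] → All Q (toList v) → ∀ j → Q (comp v j)
comp-All Vec.[]       q[] _          j             = q[]
comp-All (x Vec.∷ xs) q[] _          zero          = q[]
comp-All (x Vec.∷ xs) q[] (qx ∷ _)   (suc zero)    = qx
comp-All {Q = Q} (x Vec.∷ xs) q[] (_ ∷ qxs) (suc (suc j)) =
  subst Q (sym (comp-suc-suc x xs j)) (comp-All xs q[] qxs (suc j))

comp-setComp-same : ∀ {n} j x (v : Fact n) → 1 ≤ j → j ≤ n → comp (setComp j x v) j ≡ x
comp-setComp-same (suc zero)    x (y Vec.∷ ys) _ _         = refl
comp-setComp-same (suc (suc j)) x (y Vec.∷ ys) _ (s≤s j<n) =
  trans (comp-suc-suc y (setComp (suc j) x ys) j) (comp-setComp-same (suc j) x ys (s≤s z≤n) j<n)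

comp-setComp-other : ∀ {n} j k x (v : Fact n) → ¬ j ≡ k → comp (setComp j x v) k ≡ comp v k
comp-setComp-other j             k             x Vec.[]       _   = refl
comp-setComp-other zero          k             x (y Vec.∷ ys) _   = refl
comp-setComp-other (suc zero)    zero          x (y Vec.∷ ys) _   = refl
comp-setComp-other (suc zero)    (suc zero)    x (y Vec.∷ ys) j≢k with () ← j≢k refl
comp-setComp-other (suc zero)    (suc (suc k)) x (y Vec.∷ ys) _   =
  trans (comp-suc-suc x ys k) (sym (comp-suc-suc y ys k))
comp-setComp-other (suc (suc j)) zero          x (y Vec.∷ ys) _   = refl
comp-setComp-other (suc (suc j)) (suc zero)    x (y Vec.∷ ys) _   = refl
comp-setComp-other (suc (suc j)) (suc (suc k)) x (y Vec.∷ ys) j≢k =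
  trans (comp-suc-suc y (setComp (suc j) x ys) k)
        (trans (comp-setComp-other (suc j) (suc k) x ys (λ e → j≢k (cong suc e)))
               (sym (comp-suc-suc y ys k)))

removeFirstAbove-All : ∀ {P : ℕ → Set} b {xs} → All P xs → All P (removeFirstAbove b xs)
removeFirstAbove-All b {[]}    []         = []
removeFirstAbove-All b {a ∷ _} (pa ∷ pas) with b <ᵇ a
... | true  = pas
... | false = pa ∷ removeFirstAbove-All b pas

mutual
  pairingLoop : (lower upper : List ℕ) → List ℕ → List ℕ → List ℕ
  pairingLoop = _

  unpaired-All : ∀ {P : ℕ → Set} lower {upper} → All P upper → All P (unpaired lower upper)
  unpaired-All lower {upper} pu with reverse lower
  ... | []     = pu
  ... | b ∷ bs with removeFirstAbove b upper | removeFirstAbove-All b pu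
  ... | rest | prest = pairingLoop-All lower upper bs prest

  pairingLoop-All : ∀ {P : ℕ → Set} lower upper bs {rest} →
                    All P rest → All P (pairingLoop lower upper bs rest)
  pairingLoop-All lower upper []       prest = prest
  pairingLoop-All lower upper (b ∷ bs) prest =
    pairingLoop-All lower upper bs (removeFirstAbove-All b prest)

remove-All : ∀ {P : ℕ → Set} a {xs} → All P xs → All P (remove a xs)
remove-All a {[]}    []         = []
remove-All a {y ∷ _} (py ∷ pys) with a ≡ᵇ y
... | true  = pys
... | false = py ∷ remove-All a pys

lastM-All : ∀ {P : ℕ → Set} {xs a} → All P xs → lastM xs ≡ just a → P a
lastM-All {xs = _ ∷ []}    (px ∷ _)  refl = px
lastM-All {xs = _ ∷ _ ∷ _} (_ ∷ pxs) eq   = lastM-All pxs eq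

FlaggedRow : (ℕ → ℕ) → ℕ → List ℕ → Set
FlaggedRow φ j xs = ∀ a rest → xs ≡ a ∷ rest → j ≤ φ a

Admissible : (ℕ → ℕ) → ℕ → ℕ → Set
Admissible φ j a = 1 ≤ a × j ≤ φ a

admissible-upward : ∀ {φ j a b} → IsFlag φ → Admissible φ j a → a ≤ b → Admissible φ j b
admissible-upward (mono , _) (1≤a , j≤φa) a≤b = ≤-trans 1≤a a≤b , ≤-trans j≤φa (mono _ _ 1≤a a≤b)

increasing-admissible : ∀ {φ j xs} → IsFlag φ → Increasing xs → All (1 ≤_) xs →
                        FlaggedRow φ j xs → All (Admissible φ j) xs
increasing-admissible {xs = []}    _    _   _         _   = []
increasing-admissible {xs = h ∷ t} flag inc (1≤h ∷ _) row =
  All.map (admissible-upward flag (1≤h , row h t refl))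
          (Linked⇒All ≤-trans ≤-refl (Linked.map <⇒≤ inc))

All-FlaggedRow : ∀ {φ j xs} → All (Admissible φ j) xs → FlaggedRow φ j xs
All-FlaggedRow ((_ , j≤φa) ∷ _) a rest refl = j≤φa

insert-FlaggedRow : ∀ {φ j x} xs → j ≤ φ x → FlaggedRow φ j xs → FlaggedRow φ j (insert x xs)
insert-FlaggedRow []       j≤φx _   _ _ refl = j≤φx
insert-FlaggedRow {x = x} (y ∷ ys) j≤φx row a rest eq with x <ᵇ y | eq
... | true  | refl = j≤φx
... | false | refl = row y ys refl

setComp-Flagged : ∀ {n φ} j x (v : Fact n) → 1 ≤ j → j ≤ n →
                  Flagged φ v → FlaggedRow φ j x → Flagged φ (setComp j x v)
setComp-Flagged j x v 1≤j j≤n fl row k a rest 1≤k k≤n eq with k ≟ j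
... | yes refl = row a rest (trans (sym (comp-setComp-same j x v 1≤j j≤n)) eq)
... | no  k≢j  = fl k a rest 1≤k k≤n
                   (trans (sym (comp-setComp-other j k x v (λ e → k≢j (sym e)))) eq)

rows-positive : ∀ {n} w (v : Fact n) → Reduced (word v) w → All (All (1 ≤_)) (toList v)
rows-positive w v (pos , _) = All-resp-↭ (↭-reverse (toList v)) (concat⁻ pos)

lemma4p3 : (w : SInf) → PosWord w → (n : ℕ) → 1 ≤ n → (φ : ℕ → ℕ) → IsFlag φ →
           (i : ℕ) → 1 ≤ i → i < n → (v : Fact n) → RF n w v → Flagged φ v →
           (raise i v ≡ nothing) ⊎ Σ (Fact n) (λ v' → (raise i v ≡ just v') × Flagged φ v')
lemma4p3 w _ n _ φ flag i 1≤i i<n v (incs , red) fl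
  with lastM (unpaired (comp v i) (comp v (suc i))) in last≡a
... | nothing = inj₁ refl
... | just a  = inj₂ (_ , refl , setComp-Flagged i lower′ (setComp (suc i) upper′ v) 1≤i (<⇒≤ i<n)
                                   (setComp-Flagged (suc i) upper′ v (s≤s z≤n) i<n fl upperRow)
                                   lowerRow)
  where
  upper upper′ lower′ : List ℕ
  upper = comp v (suc i)
  upper′ = remove a upper
  lower′ = insert (a + findS a upper (suc (length upper)) 0) (comp v i)

  upper-admissible : All (Admissible φ (suc i)) upper
  upper-admissible = increasing-admissible flag (comp-All v [] incs (suc i))
                       (comp-All v [] (rows-positive w v red) (suc i))
                       (λ h t → fl (suc i) h t (s≤s z≤n) i<n)

  a-admissible : Admissible φ (suc i) a
  a-admissible = lastM-All (unpaired-All (comp v i) upper-admissible) last≡a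

  upperRow : FlaggedRow φ (suc i) upper′
  upperRow = All-FlaggedRow (remove-All a upper-admissible)

  lowerRow : FlaggedRow φ i lower′
  lowerRow = insert-FlaggedRow (comp v i)
               (≤-trans (n≤1+n i) (proj₂ (admissible-upward flag a-admissible (m≤m+n a _))))
               (λ h t → fl i h t 1≤i (<⇒≤ i<n))
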